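{- Let $S$ be a packing sequence and $P_n$ a path of order $n\ge1$. Then $P_n$ is $\chi_S$-vertex-critical if and only if it is $\chi_S$-critical.
   Context: A packing sequence is a non-decreasing infinite sequence $S=(s_1,s_2,\ldots)$ of positive integers. For a graph $G$, a map $\phi\colon V(G)\to\{1,\ldots,k\}$ is an $S$-packing $k$-coloring if any two distinct vertices $u,v$ with $\phi(u)=\phi(v)=i$ satisfy $d_G(u,v) > s_i$; $\chi_S(G)$ is the least such $k$. A graph $G$ is $\chi_S$-critical if $\chi_S(H)<\chi_S(G)$ for every proper subgraph $H$ of $G$, and $\chi_S$-vertex-critical if $\chi_S(G-v)<\chi_S(G)$ for every $v\in V(G)$. -}

module Defs where

open import Level using (0ℓ)
open import Data.Nat using (ℕ; zero; suc; _+_; _≤_; _<_)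
open import Data.Fin using (Fin; toℕ)
open import Data.Bool using (Bool; true; false; not; T)
open import Data.Product using (Σ; ∃; _×_; _,_; proj₁)
open import Data.Sum using (_⊎_; inj₁; inj₂)
open import Data.Empty using (⊥)
open import Relation.Nullary using (¬_; Dec; yes; no)
open import Relation.Nullary.Decidable using (⌊_⌋)
open import Relation.Binary.PropositionalEquality using (_≡_; _≢_; refl)
open import Relation.Binary.Definitions using (DecidableEquality)
open import Function.Bundles using (_⇔_)

-- Packing sequences: s i stands for s_{i+1} (0-indexed)

record PackingSequence : Set where
  field
    s    : ℕ → ℕ
    mono : ∀ i j → i ≤ j → s i ≤ s j
    pos  : ∀ i → 0 < s i
open PackingSequence public

record Graph : Set₁ where
  field
    V     : Set
    Adj   : V → V → Set
    sym   : ∀ {u v} → Adj u v → Adj v u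
    irref : ∀ {u} → ¬ Adj u u
open Graph public

data Walk (G : Graph) : ℕ → V G → V G → Set where
  nil  : ∀ {u} → Walk G 0 u u
  cons : ∀ {m u w v} → Adj G u w → Walk G m w v → Walk G (suc m) u v

DistLe : (G : Graph) → ℕ → V G → V G → Set
DistLe G d u v = ∃ λ m → m ≤ d × Walk G m u v

-- colour j : Fin k stands for colour j+1, whose distance bound is s_{j+1} = s S (toℕ j)
IsPackingColoring : (G : Graph) (S : PackingSequence) (k : ℕ) → (V G → Fin k) → Set
IsPackingColoring G S k φ =
  ∀ u v → u ≢ v → φ u ≡ φ v → ¬ DistLe G (s S (toℕ (φ u))) u v

Colorable : (G : Graph) (S : PackingSequence) (k : ℕ) → Set
Colorable G S k = Σ (V G → Fin k) (IsPackingColoring G S k)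

IsChiS : (G : Graph) (S : PackingSequence) (k : ℕ) → Set
IsChiS G S k = Colorable G S k × (∀ m → Colorable G S m → k ≤ m)

record SubGraph (G : Graph) : Set₁ where
  field
    keepV    : V G → Bool
    keepE    : V G → V G → Set
    keepE⇒Adj : ∀ {u v} → keepE u v → Adj G u v
    keepE⇒V₁ : ∀ {u v} → keepE u v → T (keepV u)
    keepE⇒V₂ : ∀ {u v} → keepE u v → T (keepV v)
    keepEsym : ∀ {u v} → keepE u v → keepE v u
open SubGraph public

toGraph : {G : Graph} → SubGraph G → Graph
toGraph {G} H = record
  { V     = Σ (V G) (λ v → T (keepV H v))
  ; Adj   = λ u v → keepE H (proj₁ u) (proj₁ v)
  ; sym   = keepEsym H
  ; irref = λ e → irref G (keepE⇒Adj H e)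
  }

Proper : {G : Graph} → SubGraph G → Set
Proper {G} H =
  (∃ λ v → keepV H v ≡ false) ⊎ (∃ λ u → ∃ λ v → Adj G u v × ¬ keepE H u v)

deleteVertex : (G : Graph) → DecidableEquality (V G) → V G → SubGraph G
deleteVertex G _≟_ v = record
  { keepV    = λ w → not ⌊ w ≟ v ⌋
  ; keepE    = λ a b → Adj G a b × a ≢ v × b ≢ v
  ; keepE⇒Adj = λ { (e , _ , _) → e }
  ; keepE⇒V₁ = λ { {a} (_ , p , _) → lem a p }
  ; keepE⇒V₂ = λ { {_} {b} (_ , _ , q) → lem b q }
  ; keepEsym = λ { (e , p , q) → sym G e , q , p }
  }
  where
  lem : ∀ w → w ≢ v → T (not ⌊ w ≟ v ⌋)
  lem w p with w ≟ v
  ... | yes eq = p eq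
  ... | no _ = _

ChiSCritical : (G : Graph) (S : PackingSequence) → Set₁
ChiSCritical G S =
  ∀ (H : SubGraph G) → Proper H →
  ∀ a b → IsChiS (toGraph H) S a → IsChiS G S b → a < b

ChiSVertexCritical : (G : Graph) → DecidableEquality (V G) → (S : PackingSequence) → Set
ChiSVertexCritical G _≟_ S =
  ∀ (v : V G) → ∀ a b → IsChiS (toGraph (deleteVertex G _≟_ v)) S a → IsChiS G S b → a < b

Path : ℕ → Graph
Path n = record
  { V     = Fin n
  ; Adj   = λ i j → (suc (toℕ i) ≡ toℕ j) ⊎ (suc (toℕ j) ≡ toℕ i)
  ; sym   = λ { (inj₁ p) → inj₂ p ; (inj₂ p) → inj₁ p }
  ; irref = λ { {u} (inj₁ p) → noSelf (toℕ u) p ; {u} (inj₂ p) → noSelf (toℕ u) p }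
  }
  where
  noSelf : ∀ m → suc m ≢ m
  noSelf zero ()
  noSelf (suc m) p = noSelf m (Data.Nat.Properties.suc-injective p)
    where import Data.Nat.Properties

-- Critical graphs are vertex-critical because G - v is a proper subgraph.
-- Conversely, every proper subgraph H of P_n is no harder to colour than
-- some P_n - v. If H misses the vertex v this is inclusion. If H misses the
-- edge {u, u+1}, move the vertices 0..u up by one: this maps H into P_n - 0,
-- and since no walk of H crosses the cut it is injective on vertices joined
-- by a walk, so packing colourings pull back along it. Vertex-criticality
-- then gives χ_S(H) ≤ χ_S(P_n - v) < χ_S(P_n). The number χ_S(P_n - v) only
-- exists classically, but the goal a < b is decidable, so the double-negated
-- least number principle is enough.
{-# OPTIONS --safe #-}
module Submission where

open import Defs hiding (sym)
open import Data.Nat using (ℕ; suc; _+_; _≤_; _<_; _≤?_; _<?_; z≤n; s≤s; s≤s⁻¹)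
open import Data.Nat.Properties
  using (≤-trans; ≤-antisym; ≤-<-trans; ≮⇒≥; ≰⇒>; n≤1+n; +-suc; +-cancelˡ-≡)
open import Data.Fin using (Fin; zero; toℕ; fromℕ<; _≟_)
open import Data.Fin.Properties using (toℕ-injective; toℕ-fromℕ<; toℕ<n)
open import Data.Bool using (Bool; false; T; if_then_else_)
open import Data.Bool.Properties using (T-irrelevant)
open import Data.Product using (∃; _×_; _,_; proj₁; proj₂)
open import Data.Sum using (inj₁; inj₂)
import Data.Sum as Sum
open import Data.Nat.Induction using (<-rec)
open import Function using (_∘_)
open import Effect.Monad using (RawMonad)
open import Level using (0ℓ)
open import Relation.Nullary using (¬_; yes; no)
open import Relation.Nullary.Decidable
  using (⌊_⌋; fromWitnessFalse; decidable-stable; ¬¬-excluded-middle)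
open import Relation.Nullary.Negation using (¬¬-Monad; ¬¬-map; contradiction)
open import Relation.Binary.Definitions using (DecidableEquality)
open import Relation.Binary.PropositionalEquality
  using (_≡_; _≢_; refl; sym; trans; cong; cong₂; subst; subst₂; module ≡-Reasoning)

open RawMonad (¬¬-Monad {0ℓ}) using (return; _>>=_)

Least : (ℕ → Set) → Set
Least P = ∃ λ c → P c × ∀ k → P k → c ≤ k

¬¬-least : (P : ℕ → Set) (m : ℕ) → P m → ¬ ¬ Least P
¬¬-least P = <-rec _ λ m smaller Pm → do
  no nothing-below ← ¬¬-excluded-middle {A = ∃ λ k → k < m × P k}
    where yes (k , k<m , Pk) → smaller k<m Pk
  return (m , Pm , λ k Pk → ≮⇒≥ λ k<m → nothing-below (k , k<m , Pk))

IsChiS-exists : ∀ G S {k} → Colorable G S k → ¬ ¬ ∃ (IsChiS G S)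
IsChiS-exists G S {k} = ¬¬-least (Colorable G S) k

-- χ_S(H) ≤ χ_S(G), phrased through colourability since χ_S need not exist constructively.
_≲[_]_ : Graph → PackingSequence → Graph → Set
H ≲[ S ] G = ∀ k → Colorable G S k → Colorable H S k

Homomorphism : (H G : Graph) → (V H → V G) → Set
Homomorphism H G f = ∀ {x y} → Adj H x y → Adj G (f x) (f y)

InjectiveOnWalks : (H : Graph) {A : Set} → (V H → A) → Set
InjectiveOnWalks H f = ∀ {m x y} → Walk H m x y → f x ≡ f y → x ≡ y

Walk-map : ∀ {H G} (f : V H → V G) → Homomorphism H G f →
  ∀ {m x y} → Walk H m x y → Walk G m (f x) (f y)
Walk-map f hom nil        = nil
Walk-map f hom (cons e w) = cons (hom e) (Walk-map f hom w)

Walk-invariant : ∀ {G} {A : Set} (f : V G → A) → (∀ {x y} → Adj G x y → f x ≡ f y) →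
  ∀ {m x y} → Walk G m x y → f x ≡ f y
Walk-invariant f inv nil        = refl
Walk-invariant f inv (cons e w) = trans (inv e) (Walk-invariant f inv w)

homomorphism⇒≲ : ∀ {H G} S (f : V H → V G) →
  Homomorphism H G f → InjectiveOnWalks H f → H ≲[ S ] G
homomorphism⇒≲ S f hom inj k (φ , packing) =
  φ ∘ f , λ { x y x≢y same (m , m≤ , w) →
    packing (f x) (f y) (x≢y ∘ inj w) same (m , m≤ , Walk-map f hom w) }

toGraph-proj₁-injective : ∀ {G} (K : SubGraph G) {x y : V (toGraph K)} →
  proj₁ x ≡ proj₁ y → x ≡ y
toGraph-proj₁-injective K {x , p} {.x , q} refl = cong (x ,_) (T-irrelevant p q)

toGraph-≲ : ∀ {G} S (K : SubGraph G) → toGraph K ≲[ S ] G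
toGraph-≲ S K = homomorphism⇒≲ S proj₁ (keepE⇒Adj K)
  (λ _ → toGraph-proj₁-injective K)

deleteVertex-removes : ∀ G (_≟ᵥ_ : DecidableEquality (V G)) v →
  keepV (deleteVertex G _≟ᵥ_ v) v ≡ false
deleteVertex-removes G _≟ᵥ_ v with v ≟ᵥ v
... | yes _   = refl
... | no v≢v  = contradiction refl v≢v

missingVertex⇒≲deleteVertex : ∀ G (_≟ᵥ_ : DecidableEquality (V G)) S (H : SubGraph G) {v} →
  keepV H v ≡ false → toGraph H ≲[ S ] toGraph (deleteVertex G _≟ᵥ_ v)
missingVertex⇒≲deleteVertex G _≟ᵥ_ S H {v} v∉H =
  homomorphism⇒≲ S include
    (λ { {a , _} {b , _} e → keepE⇒Adj H e , ≢v (keepE⇒V₁ H e) , ≢v (keepE⇒V₂ H e) })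
    (λ _ → toGraph-proj₁-injective H ∘ cong proj₁)
  where
  ≢v : ∀ {x} → T (keepV H x) → x ≢ v
  ≢v x∈H refl = subst T v∉H x∈H
  include : V (toGraph H) → V (toGraph (deleteVertex G _≟ᵥ_ v))
  include (x , x∈H) = x , fromWitnessFalse (≢v x∈H)

critical⇒vertexCritical : ∀ G (_≟ᵥ_ : DecidableEquality (V G)) S →
  ChiSCritical G S → ChiSVertexCritical G _≟ᵥ_ S
critical⇒vertexCritical G _≟ᵥ_ S critical v =
  critical (deleteVertex G _≟ᵥ_ v) (inj₁ (v , deleteVertex-removes G _≟ᵥ_ v))

vertexCritical⇒critical : ∀ G (_≟ᵥ_ : DecidableEquality (V G)) S →
  (∀ (H : SubGraph G) → Proper H → ∃ λ v → toGraph H ≲[ S ] toGraph (deleteVertex G _≟ᵥ_ v)) →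
  ChiSVertexCritical G _≟ᵥ_ S → ChiSCritical G S
vertexCritical⇒critical G _≟ᵥ_ S reduce vertexCritical H proper a b (_ , a-least) χG@(G-col , _) =
  decidable-stable (a <? b) (¬¬-map a<b (IsChiS-exists (toGraph G-v) S (toGraph-≲ S G-v b G-col)))
  where
  v = proj₁ (reduce H proper)
  G-v = deleteVertex G _≟ᵥ_ v
  H≲G-v = proj₂ (reduce H proper)
  a<b : ∃ (IsChiS (toGraph G-v) S) → a < b
  a<b (c , χG-v@(G-v-col , _)) =
    ≤-<-trans (a-least c (H≲G-v c G-v-col)) (vertexCritical v c b χG-v χG)

module PathCut {n} (H : SubGraph (Path (suc n))) (lo hi : Fin (suc n))
               (lo→hi : suc (toℕ lo) ≡ toℕ hi) (cut : ¬ keepE H lo hi) where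

  open ≡-Reasoning

  left : Fin (suc n) → Bool
  left x = ⌊ toℕ x ≤? toℕ lo ⌋

  offset : Bool → ℕ
  offset b = if b then 1 else 0

  lift : Fin (suc n) → ℕ
  lift x = offset (left x) + toℕ x

  lift-< : ∀ x → lift x < suc n
  lift-< x with toℕ x ≤? toℕ lo
  ... | yes x≤lo = s≤s (≤-<-trans x≤lo (s≤s⁻¹ (subst (_< suc n) (sym lo→hi) (toℕ<n hi))))
  ... | no _     = toℕ<n x

  lift≢0 : ∀ x → lift x ≢ 0
  lift≢0 x with toℕ x ≤? toℕ lo
  ... | yes _    = λ ()
  ... | no x≰lo  = λ x≡0 → x≰lo (subst (_≤ toℕ lo) (sym x≡0) z≤n)

  shift : Fin (suc n) → Fin (suc n)
  shift x = fromℕ< (lift-< x)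

  shift≢0 : ∀ x → shift x ≢ zero
  shift≢0 x eq = lift≢0 x (trans (sym (toℕ-fromℕ< (lift-< x))) (cong toℕ eq))

  left-preserved : ∀ {x y} → keepE H x y → suc (toℕ x) ≡ toℕ y → left x ≡ left y
  left-preserved {x} {y} e x→y with toℕ x ≤? toℕ lo | toℕ y ≤? toℕ lo
  ... | yes _    | yes _    = refl
  ... | no _     | no _     = refl
  ... | no x≰lo  | yes y≤lo = contradiction (≤-trans (n≤1+n _) (subst (_≤ toℕ lo) (sym x→y) y≤lo)) x≰lo
  ... | yes x≤lo | no y≰lo  = contradiction (subst₂ (keepE H) x≡lo y≡hi e) cut
    where
    x≡lo : x ≡ lo
    x≡lo = toℕ-injective (≤-antisym x≤lo (s≤s⁻¹ (subst (toℕ lo <_) (sym x→y) (≰⇒> y≰lo))))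
    y≡hi : y ≡ hi
    y≡hi = toℕ-injective (trans (sym x→y) (trans (cong (suc ∘ toℕ) x≡lo) lo→hi))

  left-Adj : ∀ {x y} → keepE H x y → left x ≡ left y
  left-Adj {x} {y} e with keepE⇒Adj H e
  ... | inj₁ x→y = left-preserved e x→y
  ... | inj₂ y→x = sym (left-preserved (keepEsym H e) y→x)

  toℕ-shift : ∀ x → toℕ (shift x) ≡ lift x
  toℕ-shift x = toℕ-fromℕ< (lift-< x)

  shift-suc : ∀ {x y} → left x ≡ left y → suc (toℕ x) ≡ toℕ y → suc (toℕ (shift x)) ≡ toℕ (shift y)
  shift-suc {x} {y} same x→y = begin
    suc (toℕ (shift x))                       ≡⟨ cong suc (toℕ-shift x) ⟩
    suc (offset (left x) + toℕ x)             ≡⟨ sym (+-suc (offset (left x)) (toℕ x)) ⟩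
    offset (left x) + suc (toℕ x)             ≡⟨ cong₂ (λ b k → offset b + k) same x→y ⟩
    offset (left y) + toℕ y                   ≡⟨ sym (toℕ-shift y) ⟩
    toℕ (shift y)                             ∎

  shift-injective : ∀ {x y} → left x ≡ left y → shift x ≡ shift y → x ≡ y
  shift-injective {x} {y} same eq = toℕ-injective (+-cancelˡ-≡ (offset (left x)) _ _ (begin
    offset (left x) + toℕ x                   ≡⟨ sym (toℕ-shift x) ⟩
    toℕ (shift x)                             ≡⟨ cong toℕ eq ⟩
    toℕ (shift y)                             ≡⟨ toℕ-shift y ⟩
    offset (left y) + toℕ y                   ≡⟨ cong (λ b → offset b + toℕ y) (sym same) ⟩
    offset (left x) + toℕ y                   ∎))

  shift-Adj : ∀ {x y} → left x ≡ left y → Adj (Path (suc n)) x y → Adj (Path (suc n)) (shift x) (shift y)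
  shift-Adj same = Sum.map (shift-suc same) (shift-suc (sym same))

  P-0 : Graph
  P-0 = toGraph (deleteVertex (Path (suc n)) _≟_ zero)

  fold : V (toGraph H) → V P-0
  fold (x , _) = shift x , fromWitnessFalse (shift≢0 x)

  fold-hom : Homomorphism (toGraph H) P-0 fold
  fold-hom {x , _} {y , _} e = shift-Adj (left-Adj e) (keepE⇒Adj H e) , shift≢0 x , shift≢0 y

  fold-injectiveOnWalks : InjectiveOnWalks (toGraph H) fold
  fold-injectiveOnWalks w eq = toGraph-proj₁-injective H
    (shift-injective (Walk-invariant (left ∘ proj₁) left-Adj w) (cong proj₁ eq))

  ≲-deleteZero : ∀ S → toGraph H ≲[ S ] P-0
  ≲-deleteZero S = homomorphism⇒≲ S fold (λ {x} {y} → fold-hom {x} {y}) fold-injectiveOnWalks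

Path-proper⇒≲deleteVertex : ∀ S n (H : SubGraph (Path n)) → Proper H →
  ∃ λ v → toGraph H ≲[ S ] toGraph (deleteVertex (Path n) _≟_ v)
Path-proper⇒≲deleteVertex S n H (inj₁ (v , v∉H)) =
  v , missingVertex⇒≲deleteVertex (Path n) _≟_ S H v∉H
Path-proper⇒≲deleteVertex S (suc n) H (inj₂ (x , y , inj₁ x→y , xy∉H)) =
  zero , PathCut.≲-deleteZero H x y x→y xy∉H S
Path-proper⇒≲deleteVertex S (suc n) H (inj₂ (x , y , inj₂ y→x , xy∉H)) =
  zero , PathCut.≲-deleteZero H y x y→x (xy∉H ∘ keepEsym H) S

proposition3p5 : (S : PackingSequence) (n : ℕ) → 1 ≤ n →
    (ChiSVertexCritical (Path n) _≟_ S → ChiSCritical (Path n) S) ×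
    (ChiSCritical (Path n) S → ChiSVertexCritical (Path n) _≟_ S)
proposition3p5 S n _ =
  vertexCritical⇒critical (Path n) _≟_ S (Path-proper⇒≲deleteVertex S n) ,
  critical⇒vertexCritical (Path n) _≟_ S
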